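{- Let $k\in\mathbb{N}$, let $\alpha_1,\ldots,\alpha_{2k}$ be natural numbers, and let $A$ be the adjacency matrix of $G=C(\alpha_1,\ldots,\alpha_{2k})$. Let $m_0$ and $m_{ -1}$ be the multiplicities of $0$ and $-1$ as eigenvalues of $A$. Then $$m_0=\sum_{i=1}^k\alpha_{2i}-k,\qquad m_{ -1}=\begin{cases}\sum_{i=1}^k\alpha_{2i-1}-k, & \text{if }\alpha_2\neq 1,\\ \sum_{i=1}^k\alpha_{2i-1}-k+1, & \text{if }\alpha_2=1.\end{cases}$$
   Context: For natural numbers $\alpha_1,\ldots,\alpha_m$, the graph $C(\alpha_1,\ldots,\alpha_m)$ is defined recursively: $C(\alpha_1)=\overline{K_{\alpha_1}}$ (edgeless graph on $\alpha_1$ vertices), and $C(\alpha_1,\ldots,\alpha_i)=\overline{C(\alpha_1,\ldots,\alpha_{i-1})\cup K_{\alpha_i}}$ for $i\ge 2$ (disjoint union with the complete graph $K_{\alpha_i}$, followed by complementation). -}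

module Defs where

open import Data.Nat using (ℕ; zero; suc; _∸_)
open import Data.Fin using (Fin; splitAt)
import Data.Fin
open import Data.Fin.Properties using (_≟_)
open import Data.Bool using (Bool; true; false; not; if_then_else_)
open import Data.Sum using (inj₁; inj₂)
open import Data.Product using (Σ; _×_)
open import Data.Rational using (ℚ; 0ℚ; 1ℚ) renaming (_+_ to _+q_; _*_ to _*q_)
import Data.Nat
open import Relation.Nullary using (¬_)
open import Relation.Nullary.Decidable using (⌊_⌋)
open import Relation.Binary.PropositionalEquality using (_≡_)

-- Sequences α₁, α₂, … are given as functions ℕ → ℕ, 1-indexed (α 0 unused).

N : (ℕ → ℕ) → ℕ → ℕ
N α zero = zero
N α (suc i) = Data.Nat._+_ (N α i) (α (suc i))

-- C(α₁) = edgeless graph on α₁ vertices;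
-- C(α₁,…,αᵢ) = complement of (C(α₁,…,αᵢ₋₁) ⊎ K_{αᵢ}); old vertices come first
-- (splitAt), new vertices of K_{αᵢ} come last.
-- one step: complement of (G ⊎ K_a), G on Fin n with adjacency g
step : (n a : ℕ) → (Fin n → Fin n → Bool) → Fin (Data.Nat._+_ n a) → Fin (Data.Nat._+_ n a) → Bool
step n a g x y with splitAt n x | splitAt n y
... | inj₁ u | inj₁ v = if ⌊ u ≟ v ⌋ then false else not (g u v)
... | inj₁ u | inj₂ v = true
... | inj₂ u | inj₁ v = true
... | inj₂ u | inj₂ v = false

adj : (α : ℕ → ℕ) → (i : ℕ) → Fin (N α i) → Fin (N α i) → Bool
adj α zero = λ x y → false
adj α (suc zero) = λ x y → false
adj α (suc (suc i)) = step (N α (suc i)) (α (suc (suc i))) (adj α (suc i))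

adjMat : (α : ℕ → ℕ) → (i : ℕ) → Fin (N α i) → Fin (N α i) → ℚ
adjMat α i x y = if adj α i x y then 1ℚ else 0ℚ

sumFin : (n : ℕ) → (Fin n → ℚ) → ℚ
sumFin zero f = 0ℚ
sumFin (suc n) f = f Data.Fin.zero +q sumFin n (λ j → f (Data.Fin.suc j))

sumTo : (ℕ → ℕ) → ℕ → ℕ
sumTo f zero = zero
sumTo f (suc k) = Data.Nat._+_ (sumTo f k) (f (suc k))

InEigenspace : {n : ℕ} → (Fin n → Fin n → ℚ) → ℚ → (Fin n → ℚ) → Set
InEigenspace {n} M λ' v = ∀ i → sumFin n (λ j → M i j *q v j) ≡ λ' *q v i

LinIndep : {n d : ℕ} → (Fin d → Fin n → ℚ) → Set
LinIndep {n} {d} v =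
  (c : Fin d → ℚ) → (∀ i → sumFin d (λ r → c r *q v r i) ≡ 0ℚ) → ∀ r → c r ≡ 0ℚ

-- λ' has multiplicity m as an eigenvalue of the (symmetric) matrix M:
-- the eigenspace {v | M v = λ' v} has dimension exactly m, i.e. it contains
-- m linearly independent vectors but not m+1.
-- (For real symmetric matrices geometric = algebraic multiplicity.)
EigenMultiplicity : {n : ℕ} → (Fin n → Fin n → ℚ) → ℚ → ℕ → Set
EigenMultiplicity {n} M λ' m =
  Σ (Fin m → Fin n → ℚ) (λ v → (∀ r → InEigenspace M λ' (v r)) × LinIndep v)
  × ((w : Fin (suc m) → Fin n → ℚ) → (∀ r → InEigenspace M λ' (w r)) → ¬ LinIndep w)

{-# OPTIONS --safe #-}
-- Write A for an adjacency matrix and 𝟙 for the all-ones vector. If G′ is the complement of G ⊎ K_a and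
-- v = (x, y) splits into old and new coordinates, then A′ v = μ v + c 𝟙 iff A x = (-1 - μ) x + (Σ v - c) 𝟙
-- and Σ x = μ y_p + c for every new vertex p. Each step of the recursion C(α₁, …, αᵢ) therefore exchanges
-- the eigenvalues 0 and -1. Along the recursion we carry m eigenvectors with coordinate sum 0 that are unit
-- vectors on m pivot coordinates, and one pair (w, γ) spanning every solution (v, c) vanishing on the pivots:
-- going from -1 to 0 the a new vertices add a - 1 such eigenvectors, going from 0 to -1 adds none (this needs
-- γ + (a - 1) Σ w ≠ 0). While γ ≠ 0 the eigenspace has dimension exactly m, since any m + 1 vectors restricted
-- to the pivots are linearly dependent. After the first steps γ and Σ w are positive; the one degenerate step
-- is C(α₁) to C(α₁, 1) = K_{α₁+1} at eigenvalue -1, handled directly, which has one more eigenvector.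
module Submission where

open import Defs

module Vectors where
  open import Algebra.Bundles using (CommutativeRing)
  import Data.Nat as ℕ
  open import Data.Fin using (Fin; zero; suc; _↑ˡ_; _↑ʳ_; splitAt; join; punchIn)
  open import Data.Fin.Properties using (_≟_; punchInᵢ≢i; join-splitAt; splitAt-↑ˡ; splitAt-↑ʳ)
  open import Data.Rational using (ℚ; 0ℚ; 1ℚ; _+_; _*_; NonNegative; Positive)
  open import Data.Rational.Properties
    using (+-*-commutativeRing; +-identityˡ; +-identityʳ; +-assoc; *-identityˡ; *-identityʳ; *-zeroˡ; *-distribʳ-+;
           nonNeg+nonNeg⇒nonNeg; pos+nonNeg⇒pos)
  open import Data.Bool using (if_then_else_)
  open import Data.Sum using (inj₁; inj₂)
  open import Data.Vec.Functional using (Vector; _++_)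
  open import Data.Vec.Functional.Properties using (lookup-++ˡ; lookup-++ʳ)
  open import Function using (_∘_; Injective)
  open import Relation.Binary.PropositionalEquality
  open import Relation.Nullary using (yes; no; contradiction)
  open import Relation.Nullary.Decidable using (⌊_⌋)
  open ≡-Reasoning

  private
    semiring = CommutativeRing.semiring +-*-commutativeRing

  open import Algebra.Properties.Semiring.Sum semiring public

  0s : ∀ {n} → Vector ℚ n
  0s _ = 0ℚ

  sumFin≡sum : ∀ n (f : Vector ℚ n) → sumFin n f ≡ sum f
  sumFin≡sum ℕ.zero f = refl
  sumFin≡sum (ℕ.suc n) f = cong (f zero +_) (sumFin≡sum n (f ∘ suc))

  sum-≗0 : ∀ {n} {f : Vector ℚ n} → (∀ i → f i ≡ 0ℚ) → sum f ≡ 0ℚ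
  sum-≗0 {n} f≗0 = trans (sum-cong-≗ f≗0) (sum-replicate-zero n)

  fromℕ : ℕ.ℕ → ℚ
  fromℕ ℕ.zero = 0ℚ
  fromℕ (ℕ.suc n) = 1ℚ + fromℕ n

  fromℕ-nonNeg : ∀ n → NonNegative (fromℕ n)
  fromℕ-nonNeg ℕ.zero = _
  fromℕ-nonNeg (ℕ.suc n) = nonNeg+nonNeg⇒nonNeg 1ℚ (fromℕ n) {{fromℕ-nonNeg n}}

  fromℕ-pos : ∀ n → Positive (fromℕ (ℕ.suc n))
  fromℕ-pos n = pos+nonNeg⇒pos 1ℚ (fromℕ n) {{fromℕ-nonNeg n}}

  sum-const : ∀ n (c : ℚ) → sum {n} (λ _ → c) ≡ fromℕ n * c
  sum-const ℕ.zero c = sym (*-zeroˡ c)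
  sum-const (ℕ.suc n) c = begin
    c + sum {n} (λ _ → c)  ≡⟨ cong₂ _+_ (sym (*-identityˡ c)) (sum-const n c) ⟩
    1ℚ * c + fromℕ n * c   ≡⟨ *-distribʳ-+ c 1ℚ (fromℕ n) ⟨
    (1ℚ + fromℕ n) * c     ∎

  data Split (m n : ℕ.ℕ) : Fin (m ℕ.+ n) → Set where
    left  : ∀ i → Split m n (i ↑ˡ n)
    right : ∀ j → Split m n (m ↑ʳ j)

  split : ∀ m n k → Split m n k
  split m n k = subst (Split m n) (join-splitAt m n k) (fromSum (splitAt m k))
    where
    fromSum : ∀ x → Split m n (join m n x)
    fromSum (inj₁ i) = left i
    fromSum (inj₂ j) = right j

  sum-split : ∀ m {n} (f : Vector ℚ (m ℕ.+ n)) → sum f ≡ sum (f ∘ (_↑ˡ n)) + sum (f ∘ (m ↑ʳ_))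
  sum-split ℕ.zero f = sym (+-identityˡ (sum f))
  sum-split (ℕ.suc m) f = trans (cong (f zero +_) (sum-split m (f ∘ suc))) (sym (+-assoc (f zero) _ _))

  sum-++ : ∀ {m n} (f : Vector ℚ m) (h : Vector ℚ n) → sum (f ++ h) ≡ sum f + sum h
  sum-++ {m} f h = trans (sum-split m (f ++ h))
    (cong₂ _+_ (sum-cong-≗ (lookup-++ˡ f h)) (sum-cong-≗ (lookup-++ʳ f h)))

  sum-++≡0 : ∀ {m n} (f : Vector ℚ m) (h : Vector ℚ n) → sum f ≡ 0ℚ → sum h ≡ 0ℚ → sum (f ++ h) ≡ 0ℚ
  sum-++≡0 f h sum-f≡0 sum-h≡0 = trans (sum-++ f h) (cong₂ _+_ sum-f≡0 sum-h≡0)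

  ↑ˡ≢↑ʳ : ∀ {m n} (i : Fin m) (j : Fin n) → i ↑ˡ n ≢ m ↑ʳ j
  ↑ˡ≢↑ʳ {m} {n} i j eq with trans (sym (splitAt-↑ˡ m i n)) (trans (cong (splitAt m) eq) (splitAt-↑ʳ m n j))
  ... | ()

  δ : ∀ {n} → Fin n → Fin n → ℚ
  δ i j = if ⌊ i ≟ j ⌋ then 1ℚ else 0ℚ

  δ-diag : ∀ {n} (i : Fin n) → δ i i ≡ 1ℚ
  δ-diag i with i ≟ i
  ... | yes _ = refl
  ... | no i≢i = contradiction refl i≢i

  δ-off : ∀ {n} {i j : Fin n} → i ≢ j → δ i j ≡ 0ℚ
  δ-off {i = i} {j} i≢j with i ≟ j
  ... | yes i≡j = contradiction i≡j i≢j
  ... | no _ = refl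

  δ-image : ∀ {m n} {f : Fin m → Fin n} → Injective _≡_ _≡_ f → ∀ i j → δ (f i) (f j) ≡ δ i j
  δ-image {f = f} f-inj i j with i ≟ j
  ... | yes refl = δ-diag (f i)
  ... | no i≢j = δ-off (i≢j ∘ f-inj)

  δ-sym : ∀ {n} (i j : Fin n) → δ i j ≡ δ j i
  δ-sym i j with i ≟ j
  ... | yes refl = sym (δ-diag i)
  ... | no i≢j = sym (δ-off (i≢j ∘ sym))

  sum-δ* : ∀ {n} (i : Fin n) (v : Vector ℚ n) → sum (λ j → δ i j * v j) ≡ v i
  sum-δ* {ℕ.suc n} i v = begin
    sum (λ j → δ i j * v j)                                    ≡⟨ sum-remove {i = i} (λ j → δ i j * v j) ⟩
    δ i i * v i + sum (λ j → δ i (punchIn i j) * v (punchIn i j)) ≡⟨ cong₂ _+_ diagonal offDiagonal ⟩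
    v i + 0ℚ                                                   ≡⟨ +-identityʳ (v i) ⟩
    v i                                                        ∎
    where
    diagonal = trans (cong (_* v i) (δ-diag i)) (*-identityˡ (v i))
    offDiagonal = sum-≗0 (λ j → trans (cong (_* v (punchIn i j)) (δ-off (punchInᵢ≢i i j ∘ sym)))
                                      (*-zeroˡ (v (punchIn i j))))

  sum-δ : ∀ {n} (i : Fin n) → sum (δ i) ≡ 1ℚ
  sum-δ i = trans (sum-cong-≗ (λ j → sym (*-identityʳ (δ i j)))) (sum-δ* i (λ _ → 1ℚ))

module LinearDependence where
  open import Data.Fin using (Fin; zero; suc; punchIn)
  open import Data.Fin.Properties using (any?)
  open import Data.Nat using (ℕ; zero; suc)
  open import Data.Product using (Σ-syntax; _×_; _,_)
  open import Data.Rational using (ℚ; 0ℚ; 1ℚ; _+_; _*_; -_; _-_; 1/_; ≢-nonZero)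
  open import Data.Rational.Properties
    using (_≟_; 1≢0; +-identityˡ; *-zeroˡ; *-zeroʳ; *-assoc; *-identityʳ; *-inverseˡ)
  open import Data.Rational.Solver using (module +-*-Solver)
  open import Data.Vec.Functional using (Vector; _∷_; insertAt)
  open import Data.Vec.Functional.Properties using (insertAt-lookup; insertAt-punchIn)
  open import Function using (_∘_)
  open import Relation.Binary.PropositionalEquality
  open import Relation.Nullary using (yes; no; ¬?)
  open import Relation.Nullary.Decidable using (decidable-stable)
  open +-*-Solver using (solve; con; _:+_; _:*_; _:-_; :-_; _:=_)
  open ≡-Reasoning
  open Vectors

  Dependent : ∀ {d m} → (Fin d → Vector ℚ m) → Set
  Dependent {d} u = Σ[ c ∈ Vector ℚ d ] (∀ s → sum (λ r → c r * u r s) ≡ 0ℚ) × Σ[ r ∈ Fin d ] c r ≢ 0ℚ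

  dependent-tail : ∀ {m} (u : Fin (suc (suc m)) → Vector ℚ (suc m)) → (∀ r → u r zero ≡ 0ℚ) →
                   Dependent (λ r s → u (suc r) (suc s)) → Dependent u
  dependent-tail u column₀≡0 (c , combination≡0 , r , cr≢0) = (0ℚ ∷ c) , combination≡0′ , suc r , cr≢0
    where
    combination≡0′ : ∀ s → sum (λ r → (0ℚ ∷ c) r * u r s) ≡ 0ℚ
    combination≡0′ zero = cong₂ _+_ (*-zeroˡ (u zero zero))
      (sum-≗0 (λ r → trans (cong (c r *_) (column₀≡0 (suc r))) (*-zeroʳ (c r))))
    combination≡0′ (suc s) = cong₂ _+_ (*-zeroˡ (u zero (suc s))) (combination≡0 s)

  module Elimination {m : ℕ} (u : Fin (suc (suc m)) → Vector ℚ (suc m)) (p : Fin (suc (suc m)))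
                     (pivot≢0 : u p zero ≢ 0ℚ) where
    private
      instance
        pivot-nonZero = ≢-nonZero pivot≢0

    ratio : Fin (suc m) → ℚ
    ratio r = u (punchIn p r) zero * 1/ u p zero

    eliminated : Fin (suc m) → Vector ℚ m
    eliminated r s = u (punchIn p r) (suc s) - ratio r * u p (suc s)

    ratio-pivot : ∀ r → ratio r * u p zero ≡ u (punchIn p r) zero
    ratio-pivot r = begin
      u (punchIn p r) zero * 1/ u p zero * u p zero    ≡⟨ *-assoc (u (punchIn p r) zero) (1/ u p zero) (u p zero) ⟩
      u (punchIn p r) zero * (1/ u p zero * u p zero)  ≡⟨ cong (u (punchIn p r) zero *_) (*-inverseˡ (u p zero)) ⟩
      u (punchIn p r) zero * 1ℚ                        ≡⟨ *-identityʳ _ ⟩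
      u (punchIn p r) zero                             ∎

    back-substitute : Dependent eliminated → Dependent u
    back-substitute (c , combination≡0 , r , cr≢0) =
      c′ , combination≡0′ , punchIn p r , cr≢0 ∘ trans (sym (insertAt-punchIn c p (- Y) r))
      where
      Y = sum (λ r → c r * ratio r)
      c′ = insertAt c p (- Y)

      pull-pivot : ∀ s → sum (λ x → c′ x * u x s) ≡ - Y * u p s + sum (λ r → c r * u (punchIn p r) s)
      pull-pivot s = trans (sum-remove {i = p} (λ x → c′ x * u x s))
        (cong₂ _+_ (cong (_* u p s) (insertAt-lookup c p (- Y)))
                   (sum-cong-≗ (λ r → cong (_* u (punchIn p r) s) (insertAt-punchIn c p (- Y) r))))

      cancel : ∀ x → - Y * x + (0ℚ + Y * x) ≡ 0ℚ
      cancel = solve 2 (λ y x → :- y :* x :+ (con 0ℚ :+ y :* x) := con 0ℚ) refl Y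

      combination≡0′ : ∀ s → sum (λ x → c′ x * u x s) ≡ 0ℚ
      combination≡0′ zero = begin
        sum (λ x → c′ x * u x zero)                              ≡⟨ pull-pivot zero ⟩
        - Y * u p zero + sum (λ r → c r * u (punchIn p r) zero)  ≡⟨ cong (- Y * u p zero +_) column ⟩
        - Y * u p zero + (0ℚ + Y * u p zero)                     ≡⟨ cancel (u p zero) ⟩
        0ℚ                                                       ∎
        where
        column : sum (λ r → c r * u (punchIn p r) zero) ≡ 0ℚ + Y * u p zero
        column = begin
          sum (λ r → c r * u (punchIn p r) zero)  ≡⟨ sum-cong-≗ (λ r → cong (c r *_) (ratio-pivot r)) ⟨
          sum (λ r → c r * (ratio r * u p zero))  ≡⟨ sum-cong-≗ (λ r → *-assoc (c r) (ratio r) (u p zero)) ⟨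
          sum (λ r → c r * ratio r * u p zero)    ≡⟨ *-distribʳ-sum (u p zero) (λ r → c r * ratio r) ⟨
          Y * u p zero                            ≡⟨ +-identityˡ (Y * u p zero) ⟨
          0ℚ + Y * u p zero                       ∎
      combination≡0′ (suc s) = begin
        sum (λ x → c′ x * u x (suc s))                       ≡⟨ pull-pivot (suc s) ⟩
        - Y * q + sum (λ r → c r * u (punchIn p r) (suc s))  ≡⟨ cong (- Y * q +_) column ⟩
        - Y * q + (0ℚ + Y * q)                               ≡⟨ cancel q ⟩
        0ℚ                                                   ∎
        where
        q = u p (suc s)
        split-row : ∀ a b t → a * b ≡ a * (b - t * q) + a * t * q
        split-row a b t = solve 4 (λ a b t q → a :* b := a :* (b :- t :* q) :+ a :* t :* q) refl a b t q
        column : sum (λ r → c r * u (punchIn p r) (suc s)) ≡ 0ℚ + Y * q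
        column = begin
          sum (λ r → c r * u (punchIn p r) (suc s))
            ≡⟨ sum-cong-≗ (λ r → split-row (c r) (u (punchIn p r) (suc s)) (ratio r)) ⟩
          sum (λ r → c r * eliminated r s + c r * ratio r * q)
            ≡⟨ ∑-distrib-+ (λ r → c r * eliminated r s) (λ r → c r * ratio r * q) ⟩
          sum (λ r → c r * eliminated r s) + sum (λ r → c r * ratio r * q)
            ≡⟨ cong₂ _+_ (combination≡0 s) (sym (*-distribʳ-sum q (λ r → c r * ratio r))) ⟩
          0ℚ + Y * q ∎

  dependent : ∀ m (u : Fin (suc m) → Vector ℚ m) → Dependent u
  dependent zero u = (λ _ → 1ℚ) , (λ ()) , zero , 1≢0
  dependent (suc m) u with any? (λ p → ¬? (u p zero ≟ 0ℚ))
  ... | yes (p , pivot≢0) = Elimination.back-substitute u p pivot≢0 (dependent m (Elimination.eliminated u p pivot≢0))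
  ... | no noPivot = dependent-tail u column₀≡0 (dependent m (λ r s → u (suc r) (suc s)))
    where
    column₀≡0 : ∀ r → u r zero ≡ 0ℚ
    column₀≡0 r = decidable-stable (u r zero ≟ 0ℚ) (noPivot ∘ (r ,_))

module Join where
  open import Data.Bool using (Bool; true; false; not; if_then_else_)
  open import Data.Fin using (Fin; _↑ˡ_; _↑ʳ_)
  open import Data.Fin.Properties using (_≟_; splitAt-↑ˡ; splitAt-↑ʳ)
  import Data.Nat as ℕ
  open import Data.Nat using (ℕ)
  open import Data.Product using (_×_; _,_)
  open import Data.Rational using (ℚ; 0ℚ; 1ℚ; _+_; _*_; -_; _-_)
  open import Data.Rational.Properties using (+-identityʳ; *-identityˡ; *-zeroˡ; *-zeroʳ; *-distribʳ-+)
  open import Data.Rational.Solver using (module +-*-Solver)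
  open import Data.Vec.Functional using (Vector; _++_; take; drop)
  open import Data.Vec.Functional.Properties using (lookup-++ˡ; lookup-++ʳ)
  open import Relation.Binary.PropositionalEquality
  open import Relation.Nullary using (yes; no; contradiction)
  open import Relation.Nullary.Decidable using (⌊_⌋)
  open +-*-Solver using (solve; con; _:+_; _:*_; _:-_; :-_; _:=_)
  open ≡-Reasoning
  open Vectors

  Graph : ℕ → Set
  Graph n = Fin n → Fin n → Bool

  Loopless : ∀ {n} → Graph n → Set
  Loopless g = ∀ x → g x x ≡ false

  adjacency : ∀ {n} → Graph n → Fin n → Fin n → ℚ
  adjacency g x y = if g x y then 1ℚ else 0ℚ

  _⊛_ : ∀ {n} → Graph n → Vector ℚ n → Vector ℚ n
  (g ⊛ v) x = sum (λ y → adjacency g x y * v y)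

  record AffineEigen {n} (g : Graph n) (μ c : ℚ) (v : Vector ℚ n) : Set where
    constructor affineEigen
    field
      equation : ∀ x → (g ⊛ v) x ≡ μ * v x + c

  open AffineEigen public

  affineEigen-cong : ∀ {n} {g : Graph n} {μ c} {v w : Vector ℚ n} → v ≗ w → AffineEigen g μ c v → AffineEigen g μ c w
  affineEigen-cong {g = g} {μ} {c} {v} {w} v≗w eigen = affineEigen λ x → begin
    (g ⊛ w) x    ≡⟨ sum-cong-≗ (λ y → cong (adjacency g x y *_) (sym (v≗w y))) ⟩
    (g ⊛ v) x    ≡⟨ equation eigen x ⟩
    μ * v x + c  ≡⟨ cong (λ t → μ * t + c) (v≗w x) ⟩
    μ * w x + c  ∎

  eigen-combination : ∀ {n d} {g : Graph n} {μ} (W : Fin d → Vector ℚ n) → (∀ r → AffineEigen g μ 0ℚ (W r)) →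
                      (c : Vector ℚ d) → AffineEigen g μ 0ℚ (λ x → sum (λ r → c r * W r x))
  eigen-combination {g = g} {μ} W eigen c = affineEigen λ x → begin
    sum (λ y → adjacency g x y * sum (λ r → c r * W r y))
      ≡⟨ sum-cong-≗ (λ y → *-distribˡ-sum (adjacency g x y) (λ r → c r * W r y)) ⟩
    sum (λ y → sum (λ r → adjacency g x y * (c r * W r y)))
      ≡⟨ ∑-comm (λ y r → adjacency g x y * (c r * W r y)) ⟩
    sum (λ r → sum (λ y → adjacency g x y * (c r * W r y)))
      ≡⟨ sum-cong-≗ (λ r → trans (sum-cong-≗ (λ y → swap (adjacency g x y) (c r) (W r y)))
                                 (sym (*-distribˡ-sum (c r) (λ y → adjacency g x y * W r y)))) ⟩
    sum (λ r → c r * (g ⊛ W r) x)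
      ≡⟨ sum-cong-≗ (λ r → cong (c r *_) (equation (eigen r) x)) ⟩
    sum (λ r → c r * (μ * W r x + 0ℚ))
      ≡⟨ sum-cong-≗ (λ r → pull (c r) (W r x)) ⟩
    sum (λ r → μ * (c r * W r x))
      ≡⟨ *-distribˡ-sum μ (λ r → c r * W r x) ⟨
    μ * sum (λ r → c r * W r x)
      ≡⟨ +-identityʳ _ ⟨
    μ * sum (λ r → c r * W r x) + 0ℚ ∎
    where
    swap : ∀ a b w → a * (b * w) ≡ b * (a * w)
    swap = solve 3 (λ a b w → a :* (b :* w) := b :* (a :* w)) refl
    pull : ∀ b w → b * (μ * w + 0ℚ) ≡ μ * (b * w)
    pull b w = solve 3 (λ m b w → b :* (m :* w :+ con 0ℚ) := m :* (b :* w)) refl μ b w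

  -- The equation of an old vertex u of the join, with x = (step ⊛ v) u, y = v u, r = (g ⊛ take n v) u and
  -- s = Σ v as in ⊛-step-old below.
  row-old⁻ : ∀ {x y r s μ c} → x + y + r ≡ s → x ≡ μ * y + c → r ≡ (- 1ℚ - μ) * y + (s - c)
  row-old⁻ {x} {y} {r} {s} {μ} {c} x+y+r≡s x≡μy+c = begin
    r
      ≡⟨ solve 3 (λ x y r → r := x :+ y :+ r :- (x :+ y)) refl x y r ⟩
    x + y + r - (x + y)
      ≡⟨ cong₂ (λ t x → t - (x + y)) x+y+r≡s x≡μy+c ⟩
    s - (μ * y + c + y)
      ≡⟨ solve 4 (λ s m y c → s :- (m :* y :+ c :+ y) := (:- con 1ℚ :- m) :* y :+ (s :- c)) refl s μ y c ⟩
    (- 1ℚ - μ) * y + (s - c) ∎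

  row-old⁺ : ∀ {x y r s μ c} → x + y + r ≡ s → r ≡ (- 1ℚ - μ) * y + (s - c) → x ≡ μ * y + c
  row-old⁺ {x} {y} {r} {s} {μ} {c} x+y+r≡s r≡ = begin
    x
      ≡⟨ solve 3 (λ x y r → x := x :+ y :+ r :- y :- r) refl x y r ⟩
    x + y + r - y - r
      ≡⟨ cong₂ (λ t r → t - y - r) x+y+r≡s r≡ ⟩
    s - y - ((- 1ℚ - μ) * y + (s - c))
      ≡⟨ solve 4 (λ s m y c → s :- y :- ((:- con 1ℚ :- m) :* y :+ (s :- c)) := m :* y :+ c) refl s μ y c ⟩
    μ * y + c ∎

  module _ {n a : ℕ} (g : Graph n) where

    step-old-old : ∀ u u′ → step n a g (u ↑ˡ a) (u′ ↑ˡ a) ≡ (if ⌊ u ≟ u′ ⌋ then false else not (g u u′))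
    step-old-old u u′ rewrite splitAt-↑ˡ n u a | splitAt-↑ˡ n u′ a = refl

    step-old-new : ∀ u p → step n a g (u ↑ˡ a) (n ↑ʳ p) ≡ true
    step-old-new u p rewrite splitAt-↑ˡ n u a | splitAt-↑ʳ n a p = refl

    step-new-old : ∀ p u → step n a g (n ↑ʳ p) (u ↑ˡ a) ≡ true
    step-new-old p u rewrite splitAt-↑ˡ n u a | splitAt-↑ʳ n a p = refl

    step-new-new : ∀ p q → step n a g (n ↑ʳ p) (n ↑ʳ q) ≡ false
    step-new-new p q rewrite splitAt-↑ʳ n a p | splitAt-↑ʳ n a q = refl

    step-loopless : Loopless (step n a g)
    step-loopless x with split n a x
    ... | right p = step-new-new p p
    ... | left u rewrite step-old-old u u with u ≟ u
    ...   | yes _ = refl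
    ...   | no u≢u = contradiction refl u≢u

    module _ (loopless : Loopless g) where

      adjacency-step-old : ∀ u u′ → adjacency (step n a g) (u ↑ˡ a) (u′ ↑ˡ a) + δ u u′ + adjacency g u u′ ≡ 1ℚ
      adjacency-step-old u u′ rewrite step-old-old u u′ with u ≟ u′
      ... | yes refl rewrite loopless u = refl
      ... | no _ with g u u′
      ...   | true = refl
      ...   | false = refl

      ⊛-step-old : ∀ v u → (step n a g ⊛ v) (u ↑ˡ a) + take n v u + (g ⊛ take n v) u ≡ sum v
      ⊛-step-old v u = begin
        (G ⊛ v) (u ↑ˡ a) + vL u + (g ⊛ vL) u
          ≡⟨ cong (λ t → t + vL u + (g ⊛ vL) u) (sum-split n (λ y → adjacency G (u ↑ˡ a) y * v y)) ⟩
        (toOld + toNew) + vL u + (g ⊛ vL) u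
          ≡⟨ cong (λ t → (toOld + t) + vL u + (g ⊛ vL) u) toNew≡sum ⟩
        (toOld + sum vR) + vL u + (g ⊛ vL) u
          ≡⟨ solve 4 (λ o r x q → o :+ r :+ x :+ q := o :+ x :+ q :+ r) refl toOld (sum vR) (vL u) ((g ⊛ vL) u) ⟩
        (toOld + vL u + (g ⊛ vL) u) + sum vR
          ≡⟨ cong (_+ sum vR) (cong (λ t → toOld + t + (g ⊛ vL) u) (sym (sum-δ* u vL))) ⟩
        (toOld + sum (λ u′ → δ u u′ * vL u′) + (g ⊛ vL) u) + sum vR
          ≡⟨ cong (_+ sum vR) three-sums ⟨
        sum (λ u′ → G-row u′ * vL u′ + δ u u′ * vL u′ + adjacency g u u′ * vL u′) + sum vR
          ≡⟨ cong (_+ sum vR) (sum-cong-≗ (λ u′ → entry u′ (vL u′))) ⟩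
        sum vL + sum vR
          ≡⟨ sum-split n v ⟨
        sum v ∎
        where
        G = step n a g
        vL = take n v
        vR = drop n v
        G-row = λ u′ → adjacency G (u ↑ˡ a) (u′ ↑ˡ a)
        toOld = sum (λ u′ → G-row u′ * vL u′)
        toNew = sum (λ p → adjacency G (u ↑ˡ a) (n ↑ʳ p) * vR p)
        toNew≡sum : toNew ≡ sum vR
        toNew≡sum = sum-cong-≗ (λ p → trans (cong (λ b → (if b then 1ℚ else 0ℚ) * vR p) (step-old-new u p))
                                            (*-identityˡ (vR p)))
        three-sums : sum (λ u′ → G-row u′ * vL u′ + δ u u′ * vL u′ + adjacency g u u′ * vL u′) ≡
                     toOld + sum (λ u′ → δ u u′ * vL u′) + (g ⊛ vL) u
        three-sums = trans (∑-distrib-+ (λ u′ → G-row u′ * vL u′ + δ u u′ * vL u′) (λ u′ → adjacency g u u′ * vL u′))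
                           (cong (_+ (g ⊛ vL) u) (∑-distrib-+ (λ u′ → G-row u′ * vL u′) (λ u′ → δ u u′ * vL u′)))
        entry : ∀ u′ x → G-row u′ * x + δ u u′ * x + adjacency g u u′ * x ≡ x
        entry u′ x = begin
          G-row u′ * x + δ u u′ * x + adjacency g u u′ * x
            ≡⟨ cong (_+ adjacency g u u′ * x) (*-distribʳ-+ x (G-row u′) (δ u u′)) ⟨
          (G-row u′ + δ u u′) * x + adjacency g u u′ * x
            ≡⟨ *-distribʳ-+ x (G-row u′ + δ u u′) (adjacency g u u′) ⟨
          (G-row u′ + δ u u′ + adjacency g u u′) * x
            ≡⟨ cong (_* x) (adjacency-step-old u u′) ⟩
          1ℚ * x
            ≡⟨ *-identityˡ x ⟩
          x ∎

    ⊛-step-new : ∀ v p → (step n a g ⊛ v) (n ↑ʳ p) ≡ sum (take n v)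
    ⊛-step-new v p = begin
      (step n a g ⊛ v) (n ↑ʳ p)   ≡⟨ sum-split n (λ y → adjacency (step n a g) (n ↑ʳ p) y * v y) ⟩
      toOld + toNew               ≡⟨ cong₂ _+_ toOld≡sum toNew≡0 ⟩
      sum (take n v) + 0ℚ         ≡⟨ +-identityʳ _ ⟩
      sum (take n v)              ∎
      where
      toOld = sum (λ u → adjacency (step n a g) (n ↑ʳ p) (u ↑ˡ a) * take n v u)
      toNew = sum (λ q → adjacency (step n a g) (n ↑ʳ p) (n ↑ʳ q) * drop n v q)
      toOld≡sum : toOld ≡ sum (take n v)
      toOld≡sum = sum-cong-≗ (λ u → trans (cong (λ b → (if b then 1ℚ else 0ℚ) * take n v u) (step-new-old p u))
                                          (*-identityˡ (take n v u)))
      toNew≡0 : toNew ≡ 0ℚ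
      toNew≡0 = sum-≗0 (λ q → trans (cong (λ b → (if b then 1ℚ else 0ℚ) * drop n v q) (step-new-new p q))
                                     (*-zeroˡ (drop n v q)))

    module _ (loopless : Loopless g) {μ c : ℚ} {v : Vector ℚ (n ℕ.+ a)} where

      affineEigen-step⁻ : AffineEigen (step n a g) μ c v →
                          AffineEigen g (- 1ℚ - μ) (sum v - c) (take n v) ×
                          (∀ p → sum (take n v) ≡ μ * drop n v p + c)
      affineEigen-step⁻ eigen =
        affineEigen (λ u → row-old⁻ {μ = μ} {c} (⊛-step-old loopless v u) (equation eigen (u ↑ˡ a))) ,
        (λ p → trans (sym (⊛-step-new v p)) (equation eigen (n ↑ʳ p)))

      affineEigen-step⁺ : AffineEigen g (- 1ℚ - μ) (sum v - c) (take n v) →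
                          (∀ p → sum (take n v) ≡ μ * drop n v p + c) →
                          AffineEigen (step n a g) μ c v
      affineEigen-step⁺ old new = affineEigen rows
        where
        rows : ∀ x → (step n a g ⊛ v) x ≡ μ * v x + c
        rows x with split n a x
        ... | left u = row-old⁺ {μ = μ} {c} (⊛-step-old loopless v u) (equation old u)
        ... | right p = trans (⊛-step-new v p) (new p)

    zero-eigen : ∀ {μ} → AffineEigen g μ 0ℚ 0s
    zero-eigen {μ} = affineEigen λ x → begin
      (g ⊛ 0s) x   ≡⟨ sum-≗0 (λ y → *-zeroʳ (adjacency g x y)) ⟩
      0ℚ           ≡⟨ cong (_+ 0ℚ) (*-zeroʳ μ) ⟨
      μ * 0ℚ + 0ℚ  ∎

    module _ (loopless : Loopless g) where

      lift-old : ∀ {μ} {f : Vector ℚ n} → AffineEigen g (- 1ℚ - μ) 0ℚ f → sum f ≡ 0ℚ →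
                 AffineEigen (step n a g) μ 0ℚ (f ++ 0s)
      lift-old {μ} {f} eigen sum≡0 = affineEigen-step⁺ loopless {μ} {0ℚ} {v} old new
        where
        v : Vector ℚ (n ℕ.+ a)
        v = f ++ 0s
        sum-v : sum v - 0ℚ ≡ 0ℚ
        sum-v = trans (+-identityʳ (sum v)) (sum-++≡0 f 0s sum≡0 (sum-replicate-zero a))
        old : AffineEigen g (- 1ℚ - μ) (sum v - 0ℚ) (take n v)
        old = subst (λ c → AffineEigen g (- 1ℚ - μ) c (take n v)) (sym sum-v)
                    (affineEigen-cong {g = g} { - 1ℚ - μ} {0ℚ} (λ u → sym (lookup-++ˡ f 0s u)) eigen)
        new : ∀ p → sum (take n v) ≡ μ * drop n v p + 0ℚ
        new p = begin
          sum (take n v)    ≡⟨ trans (sum-cong-≗ (lookup-++ˡ f 0s)) sum≡0 ⟩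
          0ℚ                ≡⟨ cong (_+ 0ℚ) (*-zeroʳ μ) ⟨
          μ * 0ℚ + 0ℚ       ≡⟨ cong (λ t → μ * t + 0ℚ) (lookup-++ʳ f 0s p) ⟨
          μ * drop n v p + 0ℚ ∎

      lift-new : ∀ {h : Vector ℚ a} → sum h ≡ 0ℚ → AffineEigen (step n a g) 0ℚ 0ℚ (0s ++ h)
      lift-new {h} sum≡0 = affineEigen-step⁺ loopless {0ℚ} {0ℚ} {v} old new
        where
        v : Vector ℚ (n ℕ.+ a)
        v = 0s ++ h
        sum-v : sum v - 0ℚ ≡ 0ℚ
        sum-v = trans (+-identityʳ (sum v)) (sum-++≡0 (0s {n}) h (sum-replicate-zero n) sum≡0)
        take≡0 : ∀ u → take n v u ≡ 0ℚ
        take≡0 = lookup-++ˡ (0s {n}) h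
        old : AffineEigen g (- 1ℚ - 0ℚ) (sum v - 0ℚ) (take n v)
        old = subst (λ c → AffineEigen g (- 1ℚ) c (take n v)) (sym sum-v)
                    (affineEigen-cong {g = g} { - 1ℚ} {0ℚ} (λ u → sym (take≡0 u)) (zero-eigen { - 1ℚ}))
        new : ∀ p → sum (take n v) ≡ 0ℚ * drop n v p + 0ℚ
        new p = trans (sum-≗0 take≡0) (sym (cong (_+ 0ℚ) (*-zeroˡ (drop n v p))))

module EigenBases where
  open import Data.Bool using (false)
  open import Data.Fin using (Fin; zero; suc; _↑ˡ_; _↑ʳ_)
  open import Data.Fin.Properties using (↑ˡ-injective; ↑ʳ-injective)
  import Data.Nat as ℕ
  open import Data.Nat using (ℕ; zero; suc; z≤n; s≤s)
  open import Data.Product using (Σ; Σ-syntax; _×_; _,_; proj₁; proj₂)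
  open import Data.Rational using (ℚ; 0ℚ; 1ℚ; _+_; _*_; -_; _-_; 1/_; NonZero; Positive; NonNegative)
  open import Data.Rational.Properties
    using (+-identityˡ; +-identityʳ; *-identityʳ; *-zeroˡ; *-zeroʳ; *-assoc; *-comm; *-inverseˡ; *-inverseʳ;
           pos⇒nonZero; pos⇒nonNeg; pos+pos⇒pos; pos+nonNeg⇒pos; nonNeg+pos⇒pos; pos*pos⇒pos; nonNeg*nonNeg⇒nonNeg)
  open import Data.Rational.Solver using (module +-*-Solver)
  open import Data.Vec.Functional using (Vector; _∷_; _++_; take; drop)
  open import Data.Vec.Functional.Properties using (lookup-++ˡ; lookup-++ʳ)
  open import Relation.Binary.PropositionalEquality
  open import Data.Vec.Functional.Relation.Unary.All.Properties using (++⁺)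
  open import Function using (_∘_; _$_)
  open import Relation.Nullary using (¬_)
  open +-*-Solver using (solve; con; _:+_; _:*_; _:-_; :-_; _:=_)
  open ≡-Reasoning
  open Vectors
  open LinearDependence
  open Join

  -- The solutions (v, c) of A v = μ v + c 𝟙 that vanish on `pivot` are the multiples of (w, γ); so when
  -- γ ≠ 0 the μ-eigenspace is spanned by `basis`.
  record EigenBasis {n} (g : Graph n) (μ : ℚ) (m : ℕ) : Set where
    field
      pivot       : Fin m → Fin n
      basis       : Fin m → Vector ℚ n
      basis-eigen : ∀ r → AffineEigen g μ 0ℚ (basis r)
      basis-sum   : ∀ r → sum (basis r) ≡ 0ℚ
      basis-pivot : ∀ r s → basis r (pivot s) ≡ δ r s
      w           : Vector ℚ n
      γ σ         : ℚ
      sum-w       : sum w ≡ σ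
      spanned     : ∀ {c v} → AffineEigen g μ c v → (∀ s → v (pivot s) ≡ 0ℚ) →
                    Σ[ ρ ∈ ℚ ] (∀ x → v x ≡ ρ * w x) × c ≡ ρ * γ

  x*y≡0⇒x≡0 : ∀ x y .{{_ : NonZero y}} → x * y ≡ 0ℚ → x ≡ 0ℚ
  x*y≡0⇒x≡0 x y xy≡0 = begin
    x                 ≡⟨ *-identityʳ x ⟨
    x * 1ℚ            ≡⟨ cong (x *_) (*-inverseʳ y) ⟨
    x * (y * 1/ y)    ≡⟨ *-assoc x y (1/ y) ⟨
    x * y * 1/ y      ≡⟨ cong (_* 1/ y) xy≡0 ⟩
    0ℚ * 1/ y         ≡⟨ *-zeroˡ (1/ y) ⟩
    0ℚ                ∎

  multiplicity : ∀ {n} {g : Graph n} {μ m} (B : EigenBasis g μ m) → .{{NonZero (EigenBasis.γ B)}} →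
                 EigenMultiplicity (adjacency g) μ m
  multiplicity {n} {g} {μ} {m} B = (basis , (λ r → toInEigenspace (basis-eigen r)) , independent) , atMost
    where
    open EigenBasis B

    toInEigenspace : ∀ {v} → AffineEigen g μ 0ℚ v → InEigenspace (adjacency g) μ v
    toInEigenspace {v} eigen x =
      trans (sumFin≡sum n (λ y → adjacency g x y * v y)) (trans (equation eigen x) (+-identityʳ (μ * v x)))

    fromInEigenspace : ∀ {v} → InEigenspace (adjacency g) μ v → AffineEigen g μ 0ℚ v
    fromInEigenspace {v} eigen = affineEigen λ x →
      trans (sym (sumFin≡sum n (λ y → adjacency g x y * v y))) (trans (eigen x) (sym (+-identityʳ (μ * v x))))

    independent : LinIndep basis
    independent c combination≡0 r = begin
      c r                                       ≡⟨ sum-δ* r c ⟨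
      sum (λ s → δ r s * c s)                   ≡⟨ sum-cong-≗ (λ s → trans (*-comm (δ r s) (c s))
                                                     (cong (c s *_) (trans (δ-sym r s) (sym (basis-pivot s r))))) ⟩
      sum (λ s → c s * basis s (pivot r))       ≡⟨ sumFin≡sum m (λ s → c s * basis s (pivot r)) ⟨
      sumFin m (λ s → c s * basis s (pivot r))  ≡⟨ combination≡0 (pivot r) ⟩
      0ℚ                                        ∎

    atMost : (W : Fin (suc m) → Vector ℚ n) → (∀ r → InEigenspace (adjacency g) μ (W r)) → ¬ LinIndep W
    atMost W W-eigen W-independent with dependent m (λ r s → W r (pivot s))
    ... | c , combination≡0 , r , cr≢0 = cr≢0 (W-independent c combination≡0′ r)
      where
      combination-eigen = eigen-combination {g = g} {μ} W (λ r → fromInEigenspace (W-eigen r)) c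
      combination = spanned combination-eigen combination≡0
      ρ = proj₁ combination
      ρ≡0 : ρ ≡ 0ℚ
      ρ≡0 = x*y≡0⇒x≡0 ρ γ (sym (proj₂ (proj₂ combination)))
      combination≡0′ : ∀ x → sumFin (suc m) (λ r → c r * W r x) ≡ 0ℚ
      combination≡0′ x = begin
        sumFin (suc m) (λ r → c r * W r x)  ≡⟨ sumFin≡sum (suc m) (λ r → c r * W r x) ⟩
        sum (λ r → c r * W r x)             ≡⟨ proj₁ (proj₂ combination) x ⟩
        ρ * w x                             ≡⟨ cong (_* w x) ρ≡0 ⟩
        0ℚ * w x                            ≡⟨ *-zeroˡ (w x) ⟩
        0ℚ                                  ∎

  empty : ∀ {μ} (g : Graph 0) → EigenBasis g μ 0
  empty g = record
    { pivot = λ ()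
    ; basis = λ ()
    ; basis-eigen = λ ()
    ; basis-sum = λ ()
    ; basis-pivot = λ ()
    ; w = λ ()
    ; γ = 1ℚ
    ; σ = 0ℚ
    ; sum-w = refl
    ; spanned = λ {c} _ _ → c , (λ ()) , sym (*-identityʳ c)
    }

  module KernelStep {n a m : ℕ} {g : Graph n} (loopless : Loopless g) (B : EigenBasis g (- 1ℚ) m) where
    open EigenBasis B

    private
      G = step n (suc a) g

    -- The a+1 new, pairwise non-adjacent vertices carry the kernel vectors e_{q+1} - e_0; the remaining
    -- direction lives on their first vertex.
    pivot-old : Fin m → Fin (n ℕ.+ suc a)
    pivot-old s = pivot s ↑ˡ suc a

    pivot-new : Fin a → Fin (n ℕ.+ suc a)
    pivot-new q = n ↑ʳ suc q

    basis-old : Fin m → Vector ℚ (n ℕ.+ suc a)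
    basis-old r = basis r ++ 0s

    basis-new : Fin a → Vector ℚ (n ℕ.+ suc a)
    basis-new q = 0s ++ (- 1ℚ ∷ δ q)

    pivot′ : Fin (m ℕ.+ a) → Fin (n ℕ.+ suc a)
    pivot′ = pivot-old ++ pivot-new

    basis′ : Fin (m ℕ.+ a) → Vector ℚ (n ℕ.+ suc a)
    basis′ = basis-old ++ basis-new

    w′ : Vector ℚ (n ℕ.+ suc a)
    w′ = w ++ (γ ∷ 0s)

    basis′-eigen : ∀ r → AffineEigen G 0ℚ 0ℚ (basis′ r)
    basis′-eigen = ++⁺ (AffineEigen G 0ℚ 0ℚ) {xs = basis-old} {ys = basis-new}
      (λ r → lift-old g loopless {0ℚ} (basis-eigen r) (basis-sum r))
      (λ q → lift-new g loopless {h = - 1ℚ ∷ δ q} (cong (- 1ℚ +_) (sum-δ q)))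

    basis′-sum : ∀ r → sum (basis′ r) ≡ 0ℚ
    basis′-sum = ++⁺ (λ v → sum v ≡ 0ℚ) {xs = basis-old} {ys = basis-new}
      (λ r → sum-++≡0 (basis r) 0s (basis-sum r) (sum-replicate-zero (suc a)))
      (λ q → sum-++≡0 (0s {n}) (- 1ℚ ∷ δ q) (sum-replicate-zero n) (cong (- 1ℚ +_) (sum-δ q)))

    basis′-pivot : ∀ r s → basis′ r (pivot′ s) ≡ δ r s
    basis′-pivot r s with split m a r | split m a s
    ... | left r | left s = begin
      basis′ (r ↑ˡ a) (pivot′ (s ↑ˡ a))
        ≡⟨ cong₂ _$_ (lookup-++ˡ basis-old basis-new r) (lookup-++ˡ pivot-old pivot-new s) ⟩
      basis-old r (pivot-old s)
        ≡⟨ lookup-++ˡ (basis r) 0s (pivot s) ⟩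
      basis r (pivot s)
        ≡⟨ basis-pivot r s ⟩
      δ r s
        ≡⟨ δ-image (↑ˡ-injective a _ _) r s ⟨
      δ (r ↑ˡ a) (s ↑ˡ a) ∎
    ... | left r | right q = begin
      basis′ (r ↑ˡ a) (pivot′ (m ↑ʳ q))
        ≡⟨ cong₂ _$_ (lookup-++ˡ basis-old basis-new r) (lookup-++ʳ pivot-old pivot-new q) ⟩
      basis-old r (pivot-new q)
        ≡⟨ lookup-++ʳ (basis r) 0s (suc q) ⟩
      0ℚ
        ≡⟨ δ-off (↑ˡ≢↑ʳ r q) ⟨
      δ (r ↑ˡ a) (m ↑ʳ q) ∎
    ... | right p | left s = begin
      basis′ (m ↑ʳ p) (pivot′ (s ↑ˡ a))
        ≡⟨ cong₂ _$_ (lookup-++ʳ basis-old basis-new p) (lookup-++ˡ pivot-old pivot-new s) ⟩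
      basis-new p (pivot-old s)
        ≡⟨ lookup-++ˡ (0s {n}) (- 1ℚ ∷ δ p) (pivot s) ⟩
      0ℚ
        ≡⟨ δ-off (↑ˡ≢↑ʳ s p ∘ sym) ⟨
      δ (m ↑ʳ p) (s ↑ˡ a) ∎
    ... | right p | right q = begin
      basis′ (m ↑ʳ p) (pivot′ (m ↑ʳ q))
        ≡⟨ cong₂ _$_ (lookup-++ʳ basis-old basis-new p) (lookup-++ʳ pivot-old pivot-new q) ⟩
      basis-new p (pivot-new q)
        ≡⟨ lookup-++ʳ (0s {n}) (- 1ℚ ∷ δ p) (suc q) ⟩
      δ p q
        ≡⟨ δ-image (↑ʳ-injective m _ _) p q ⟨
      δ (m ↑ʳ p) (m ↑ʳ q) ∎

    sum-w′ : sum w′ ≡ σ + γ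
    sum-w′ = trans (sum-++ w (γ ∷ 0s))
                   (cong₂ _+_ sum-w (trans (cong (γ +_) (sum-replicate-zero a)) (+-identityʳ γ)))

    module Solution {c : ℚ} {v : Vector ℚ (n ℕ.+ suc a)} (eigen : AffineEigen G 0ℚ c v)
                    (vanishes : ∀ s → v (pivot′ s) ≡ 0ℚ) where
      private
        old-eigen : AffineEigen g (- 1ℚ) (sum v - c) (take n v)
        old-eigen = proj₁ (affineEigen-step⁻ g loopless eigen)

        new-rows : ∀ p → sum (take n v) ≡ 0ℚ * drop n v p + c
        new-rows = proj₂ (affineEigen-step⁻ g loopless eigen)

        old-vanishes : ∀ s → take n v (pivot s) ≡ 0ℚ
        old-vanishes s = trans (cong v (sym (lookup-++ˡ pivot-old pivot-new s))) (vanishes (s ↑ˡ a))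

        new-vanishes : ∀ q → drop n v (suc q) ≡ 0ℚ
        new-vanishes q = trans (cong v (sym (lookup-++ʳ pivot-old pivot-new q))) (vanishes (m ↑ʳ q))

        c≡sum-old : c ≡ sum (take n v)
        c≡sum-old = sym (trans (new-rows zero) (trans (cong (_+ c) (*-zeroˡ (drop n v zero))) (+-identityˡ c)))

        module _ {ρ : ℚ} (old≗ρw : ∀ u → take n v u ≡ ρ * w u) (sum-v-c≡ργ : sum v - c ≡ ρ * γ) where

          sum-old : sum (take n v) ≡ ρ * σ
          sum-old = begin
            sum (take n v)          ≡⟨ sum-cong-≗ old≗ρw ⟩
            sum (λ u → ρ * w u)     ≡⟨ *-distribˡ-sum ρ w ⟨
            ρ * sum w               ≡⟨ cong (ρ *_) sum-w ⟩
            ρ * σ                   ∎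

          first-new : drop n v zero ≡ ρ * γ
          first-new = begin
            drop n v zero
              ≡⟨ solve 2 (λ c x → x := c :+ (x :+ con 0ℚ) :- c) refl c (drop n v zero) ⟩
            c + (drop n v zero + 0ℚ) - c
              ≡⟨ cong (λ t → c + (drop n v zero + t) - c) (sum-≗0 new-vanishes) ⟨
            c + sum (drop n v) - c
              ≡⟨ cong (λ t → t + sum (drop n v) - c) c≡sum-old ⟩
            sum (take n v) + sum (drop n v) - c
              ≡⟨ cong (_- c) (sum-split n v) ⟨
            sum v - c
              ≡⟨ sum-v-c≡ργ ⟩
            ρ * γ ∎

          v≗ρw′ : ∀ x → v x ≡ ρ * w′ x
          v≗ρw′ x with split n (suc a) x
          ... | left u = trans (old≗ρw u) (cong (ρ *_) (sym (lookup-++ˡ w (γ ∷ 0s) u)))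
          ... | right zero = trans first-new (cong (ρ *_) (sym (lookup-++ʳ w (γ ∷ 0s) zero)))
          ... | right (suc q) = begin
            v (n ↑ʳ suc q)               ≡⟨ new-vanishes q ⟩
            0ℚ                           ≡⟨ *-zeroʳ ρ ⟨
            ρ * 0ℚ                       ≡⟨ cong (ρ *_) (lookup-++ʳ w (γ ∷ 0s) (suc q)) ⟨
            ρ * w′ (n ↑ʳ suc q)          ∎

      spanned′ : Σ[ ρ ∈ ℚ ] (∀ x → v x ≡ ρ * w′ x) × c ≡ ρ * σ
      spanned′ = ρ , v≗ρw′ {ρ} old≗ρw sum-v-c≡ργ , trans c≡sum-old (sum-old {ρ} old≗ρw sum-v-c≡ργ)
        where
        open Σ (spanned old-eigen old-vanishes) renaming (proj₁ to ρ; proj₂ to facts)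
        open Σ facts renaming (proj₁ to old≗ρw; proj₂ to sum-v-c≡ργ)

    eigenBasis : EigenBasis G 0ℚ (m ℕ.+ a)
    eigenBasis = record
      { pivot = pivot′
      ; basis = basis′
      ; basis-eigen = basis′-eigen
      ; basis-sum = basis′-sum
      ; basis-pivot = basis′-pivot
      ; w = w′
      ; γ = σ
      ; σ = σ + γ
      ; sum-w = sum-w′
      ; spanned = Solution.spanned′
      }

  module MinusOneStep {n a m : ℕ} {g : Graph n} (loopless : Loopless g) (B : EigenBasis g 0ℚ m) where
    open EigenBasis B

    private
      G = step n (suc a) g

    A K : ℚ
    A = fromℕ a
    K = γ + A * σ

    pivot′ : Fin m → Fin (n ℕ.+ suc a)
    pivot′ s = pivot s ↑ˡ suc a

    basis′ : Fin m → Vector ℚ (n ℕ.+ suc a)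
    basis′ r = basis r ++ 0s

    -- New vertices are adjacent to all old ones and to no new one, so a (-1)-solution is constant on them.
    w′ : Vector ℚ (n ℕ.+ suc a)
    w′ = (λ u → A * w u) ++ (λ _ → γ)

    σ′ : ℚ
    σ′ = A * σ + fromℕ (suc a) * γ

    sum-w′ : sum w′ ≡ σ′
    sum-w′ = trans (sum-++ (λ u → A * w u) (λ _ → γ))
      (cong₂ _+_ (trans (sym (*-distribˡ-sum A w)) (cong (A *_) sum-w)) (sum-const (suc a) γ))

    module Solution .{{K≢0 : NonZero K}} {c : ℚ} {v : Vector ℚ (n ℕ.+ suc a)} (eigen : AffineEigen G (- 1ℚ) c v)
                    (vanishes : ∀ s → v (pivot′ s) ≡ 0ℚ) where
      private
        old-eigen : AffineEigen g 0ℚ (sum v - c) (take n v)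
        old-eigen = proj₁ (affineEigen-step⁻ g loopless eigen)

        new-rows : ∀ p → sum (take n v) ≡ - 1ℚ * drop n v p + c
        new-rows = proj₂ (affineEigen-step⁻ g loopless eigen)

        ρ : ℚ
        ρ = c * 1/ K

        c≡ρK : c ≡ ρ * K
        c≡ρK = sym (begin
          c * 1/ K * K      ≡⟨ *-assoc c (1/ K) K ⟩
          c * (1/ K * K)    ≡⟨ cong (c *_) (*-inverseˡ K) ⟩
          c * 1ℚ            ≡⟨ *-identityʳ c ⟩
          c                 ∎)

        module _ {s₀ : ℚ} (old≗s₀w : ∀ u → take n v u ≡ s₀ * w u) (sum-v-c≡s₀γ : sum v - c ≡ s₀ * γ) where

          sum-old : sum (take n v) ≡ s₀ * σ
          sum-old = begin
            sum (take n v)          ≡⟨ sum-cong-≗ old≗s₀w ⟩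
            sum (λ u → s₀ * w u)    ≡⟨ *-distribˡ-sum s₀ w ⟨
            s₀ * sum w              ≡⟨ cong (s₀ *_) sum-w ⟩
            s₀ * σ                  ∎

          new≡ : ∀ p → drop n v p ≡ c - s₀ * σ
          new≡ p = begin
            drop n v p                      ≡⟨ solve 2 (λ x c → x := c :- (:- con 1ℚ :* x :+ c)) refl (drop n v p) c ⟩
            c - (- 1ℚ * drop n v p + c)     ≡⟨ cong (λ t → c - t) (new-rows p) ⟨
            c - sum (take n v)              ≡⟨ cong (λ t → c - t) sum-old ⟩
            c - s₀ * σ                      ∎

          sum-new : sum (drop n v) ≡ (1ℚ + A) * (c - s₀ * σ)
          sum-new = trans (sum-cong-≗ new≡) (sum-const (suc a) (c - s₀ * σ))

          balance : A * c ≡ s₀ * K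
          balance = begin
            A * c
              ≡⟨ solve 4 (λ A c s S → A :* c := s :* S :+ (con 1ℚ :+ A) :* (c :- s :* S) :- c :+ A :* s :* S)
                         refl A c s₀ σ ⟩
            s₀ * σ + (1ℚ + A) * (c - s₀ * σ) - c + A * s₀ * σ
              ≡⟨ cong (λ t → t - c + A * s₀ * σ) (cong₂ _+_ sum-old sum-new) ⟨
            sum (take n v) + sum (drop n v) - c + A * s₀ * σ
              ≡⟨ cong (λ t → t - c + A * s₀ * σ) (sum-split n v) ⟨
            sum v - c + A * s₀ * σ
              ≡⟨ cong (_+ A * s₀ * σ) sum-v-c≡s₀γ ⟩
            s₀ * γ + A * s₀ * σ
              ≡⟨ solve 4 (λ A s S y → s :* y :+ A :* s :* S := s :* (y :+ A :* S)) refl A s₀ σ γ ⟩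
            s₀ * K ∎

          s₀≡ρA : s₀ ≡ ρ * A
          s₀≡ρA = begin
            s₀                  ≡⟨ *-identityʳ s₀ ⟨
            s₀ * 1ℚ             ≡⟨ cong (s₀ *_) (*-inverseʳ K) ⟨
            s₀ * (K * 1/ K)     ≡⟨ *-assoc s₀ K (1/ K) ⟨
            s₀ * K * 1/ K       ≡⟨ cong (_* 1/ K) balance ⟨
            A * c * 1/ K        ≡⟨ solve 3 (λ A c i → A :* c :* i := c :* i :* A) refl A c (1/ K) ⟩
            ρ * A               ∎

          v≗ρw′ : ∀ x → v x ≡ ρ * w′ x
          v≗ρw′ x with split n (suc a) x
          ... | left u = begin
            v (u ↑ˡ suc a)           ≡⟨ old≗s₀w u ⟩
            s₀ * w u                 ≡⟨ cong (_* w u) s₀≡ρA ⟩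
            ρ * A * w u              ≡⟨ *-assoc ρ A (w u) ⟩
            ρ * (A * w u)            ≡⟨ cong (ρ *_) (lookup-++ˡ (λ u → A * w u) (λ _ → γ) u) ⟨
            ρ * w′ (u ↑ˡ suc a)      ∎
          ... | right p = begin
            v (n ↑ʳ p)               ≡⟨ new≡ p ⟩
            c - s₀ * σ               ≡⟨ cong₂ (λ x y → x - y * σ) c≡ρK s₀≡ρA ⟩
            ρ * K - ρ * A * σ        ≡⟨ solve 4 (λ r y A S → r :* (y :+ A :* S) :- r :* A :* S := r :* y) refl ρ γ A σ ⟩
            ρ * γ                    ≡⟨ cong (ρ *_) (lookup-++ʳ (λ u → A * w u) (λ _ → γ) p) ⟨
            ρ * w′ (n ↑ʳ p)          ∎

      spanned′ : Σ[ ρ ∈ ℚ ] (∀ x → v x ≡ ρ * w′ x) × c ≡ ρ * K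
      spanned′ = ρ , v≗ρw′ {s₀} old≗s₀w sum-v-c≡s₀γ , c≡ρK
        where
        open Σ (spanned old-eigen vanishes) renaming (proj₁ to s₀; proj₂ to facts)
        open Σ facts renaming (proj₁ to old≗s₀w; proj₂ to sum-v-c≡s₀γ)

    eigenBasis : .{{NonZero K}} → EigenBasis G (- 1ℚ) m
    eigenBasis = record
      { pivot = pivot′
      ; basis = basis′
      ; basis-eigen = λ r → lift-old g loopless { - 1ℚ} (basis-eigen r) (basis-sum r)
      ; basis-sum = λ r → sum-++≡0 (basis r) 0s (basis-sum r) (sum-replicate-zero (suc a))
      ; basis-pivot = λ r s → trans (lookup-++ˡ (basis r) 0s (pivot s)) (basis-pivot r s)
      ; w = w′
      ; γ = K
      ; σ = σ′
      ; sum-w = sum-w′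
      ; spanned = Solution.spanned′
      }

  module Complete (n : ℕ) where
    private
      edgeless : Graph n
      edgeless _ _ = false

      G = step n 1 edgeless

      1s -1s : Vector ℚ 1
      1s _ = 1ℚ
      -1s _ = - 1ℚ

      edgeless-eigen : ∀ {v} → AffineEigen edgeless 0ℚ 0ℚ v
      edgeless-eigen {v} = affineEigen λ x → trans (sum-≗0 (λ y → *-zeroˡ (v y))) (sym (cong (_+ 0ℚ) (*-zeroˡ (v x))))

    pivot′ : Fin n → Fin (n ℕ.+ 1)
    pivot′ u = u ↑ˡ 1

    basis′ : Fin n → Vector ℚ (n ℕ.+ 1)
    basis′ u = δ u ++ -1s

    w′ : Vector ℚ (n ℕ.+ 1)
    w′ = 0s {n} ++ 1s

    basis′-sum : ∀ u → sum (basis′ u) ≡ 0ℚ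
    basis′-sum u = trans (sum-++ (δ u) -1s) (cong (_+ (- 1ℚ + 0ℚ)) (sum-δ u))

    basis′-eigen : ∀ u → AffineEigen G (- 1ℚ) 0ℚ (basis′ u)
    basis′-eigen u = affineEigen-step⁺ edgeless (λ _ → refl) {v = basis′ u} old new
      where
      old : AffineEigen edgeless 0ℚ (sum (basis′ u) - 0ℚ) (take n (basis′ u))
      old = subst (λ c → AffineEigen edgeless 0ℚ c (take n (basis′ u)))
                  (sym (trans (+-identityʳ (sum (basis′ u))) (basis′-sum u))) edgeless-eigen
      new : ∀ p → sum (take n (basis′ u)) ≡ - 1ℚ * basis′ u (n ↑ʳ p) + 0ℚ
      new p = begin
        sum (take n (basis′ u))          ≡⟨ sum-cong-≗ (lookup-++ˡ (δ u) -1s) ⟩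
        sum (δ u)                        ≡⟨ sum-δ u ⟩
        - 1ℚ * - 1ℚ + 0ℚ                 ≡⟨ cong (λ t → - 1ℚ * t + 0ℚ) (lookup-++ʳ (δ u) -1s p) ⟨
        - 1ℚ * basis′ u (n ↑ʳ p) + 0ℚ    ∎

    sum-w′ : sum w′ ≡ 1ℚ
    sum-w′ = trans (sum-++ (0s {n}) 1s) (cong (_+ (1ℚ + 0ℚ)) (sum-replicate-zero n))

    spanned′ : ∀ {c v} → AffineEigen G (- 1ℚ) c v → (∀ s → v (pivot′ s) ≡ 0ℚ) →
               Σ[ ρ ∈ ℚ ] (∀ x → v x ≡ ρ * w′ x) × c ≡ ρ * 1ℚ
    spanned′ {c} {v} eigen vanishes = c , v≗cw′ , sym (*-identityʳ c)
      where
      new-row : sum (take n v) ≡ - 1ℚ * v (n ↑ʳ zero) + c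
      new-row = proj₂ (affineEigen-step⁻ edgeless (λ _ → refl) eigen) zero
      last≡c : v (n ↑ʳ zero) ≡ c
      last≡c = begin
        v (n ↑ʳ zero)
          ≡⟨ solve 2 (λ x c → x := c :- (:- con 1ℚ :* x :+ c)) refl (v (n ↑ʳ zero)) c ⟩
        c - (- 1ℚ * v (n ↑ʳ zero) + c)
          ≡⟨ cong (λ t → c - t) new-row ⟨
        c - sum (take n v)
          ≡⟨ cong (λ t → c - t) (sum-≗0 vanishes) ⟩
        c - 0ℚ
          ≡⟨ +-identityʳ c ⟩
        c ∎
      v≗cw′ : ∀ x → v x ≡ c * w′ x
      v≗cw′ x with split n 1 x
      ... | left u = begin
        v (u ↑ˡ 1)        ≡⟨ vanishes u ⟩
        0ℚ                ≡⟨ *-zeroʳ c ⟨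
        c * 0ℚ            ≡⟨ cong (c *_) (lookup-++ˡ (0s {n}) 1s u) ⟨
        c * w′ (u ↑ˡ 1)   ∎
      ... | right zero = begin
        v (n ↑ʳ zero)     ≡⟨ last≡c ⟩
        c                 ≡⟨ *-identityʳ c ⟨
        c * 1ℚ            ≡⟨ cong (c *_) (lookup-++ʳ (0s {n}) 1s zero) ⟨
        c * w′ (n ↑ʳ zero) ∎

    eigenBasis : EigenBasis G (- 1ℚ) n
    eigenBasis = record
      { pivot = pivot′
      ; basis = basis′
      ; basis-eigen = basis′-eigen
      ; basis-sum = basis′-sum
      ; basis-pivot = λ u → lookup-++ˡ (δ u) -1s
      ; w = w′
      ; γ = 1ℚ
      ; σ = 1ℚ
      ; sum-w = sum-w′
      ; spanned = spanned′
      }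

  Nondegenerate : ∀ {n} {g : Graph n} {μ m} → EigenBasis g μ m → Set
  Nondegenerate B = Positive (EigenBasis.γ B) × Positive (EigenBasis.σ B)

  NondegenerateBasis : ∀ {n} → Graph n → ℚ → ℕ → Set
  NondegenerateBasis g μ m = Σ (EigenBasis g μ m) Nondegenerate

  nondegenerate-multiplicity : ∀ {n} {g : Graph n} {μ m} → NondegenerateBasis g μ m →
                               EigenMultiplicity (adjacency g) μ m
  nondegenerate-multiplicity (B , γ>0 , _) = multiplicity B {{pos⇒nonZero (EigenBasis.γ B) {{γ>0}}}}

  kernelStep : ∀ {n a m} {g : Graph n} → 1 ℕ.≤ a → Loopless g → NondegenerateBasis g (- 1ℚ) m →
               NondegenerateBasis (step n a g) 0ℚ (m ℕ.+ (a ℕ.∸ 1))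
  kernelStep {a = suc _} _ loopless (B , γ>0 , σ>0) =
    KernelStep.eigenBasis loopless B , σ>0 , pos+pos⇒pos (EigenBasis.σ B) {{σ>0}} (EigenBasis.γ B) {{γ>0}}

  module _ {n a m : ℕ} {g : Graph n} (loopless : Loopless g) (B : EigenBasis g 0ℚ m) where
    open EigenBasis B
    open MinusOneStep {a = a} loopless B using (A; K; σ′)

    minusOneStep-nondegenerate : NonNegative γ → NonNegative σ → (K>0 : Positive K) →
                        Nondegenerate (MinusOneStep.eigenBasis {a = a} loopless B {{pos⇒nonZero K {{K>0}}}})
    minusOneStep-nondegenerate γ≥0 σ≥0 K>0 = K>0 , subst Positive (sym σ′≡K+Aγ) K+Aγ>0
      where
      σ′≡K+Aγ : σ′ ≡ K + A * γ
      σ′≡K+Aγ = solve 3 (λ A S y → A :* S :+ (con 1ℚ :+ A) :* y := y :+ A :* S :+ A :* y) refl A σ γ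
      K+Aγ>0 : Positive (K + A * γ)
      K+Aγ>0 = pos+nonNeg⇒pos K {{K>0}} (A * γ) {{nonNeg*nonNeg⇒nonNeg A {{fromℕ-nonNeg a}} γ {{γ≥0}}}}

  minusOneStep : ∀ {n a m} {g : Graph n} → 1 ℕ.≤ a → Loopless g → NondegenerateBasis g 0ℚ m →
                 NondegenerateBasis (step n a g) (- 1ℚ) m
  minusOneStep {a = suc a} _ loopless (B , γ>0 , σ>0) =
    MinusOneStep.eigenBasis loopless B {{pos⇒nonZero (MinusOneStep.K {a = a} loopless B) {{K>0}}}} ,
    minusOneStep-nondegenerate {a = a} loopless B γ≥0 σ≥0 K>0
    where
    open EigenBasis B
    γ≥0 = pos⇒nonNeg γ {{γ>0}}
    σ≥0 = pos⇒nonNeg σ {{σ>0}}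
    K>0 : Positive (MinusOneStep.K {a = a} loopless B)
    K>0 = pos+nonNeg⇒pos γ {{γ>0}} (fromℕ a * σ) {{nonNeg*nonNeg⇒nonNeg (fromℕ a) {{fromℕ-nonNeg a}} σ {{σ≥0}}}}

  edgelessBasis : ∀ {a} (g : Graph 0) → 1 ℕ.≤ a → NondegenerateBasis (step 0 a g) (- 1ℚ) 0
  edgelessBasis {suc a} g _ =
    MinusOneStep.eigenBasis (λ ()) (empty g) {{pos⇒nonZero (MinusOneStep.K {a = a} (λ ()) (empty g)) {{K>0}}}} ,
    minusOneStep-nondegenerate {a = a} (λ ()) (empty g) _ _ K>0
    where
    K>0 : Positive (MinusOneStep.K {a = a} (λ ()) (empty g))
    K>0 = pos+nonNeg⇒pos 1ℚ (fromℕ a * 0ℚ) {{nonNeg*nonNeg⇒nonNeg (fromℕ a) {{fromℕ-nonNeg a}} 0ℚ}}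

  completeSplitBasis : ∀ {a₁ a₂} (g : Graph 0) → 1 ℕ.≤ a₁ → 2 ℕ.≤ a₂ →
                       NondegenerateBasis (step a₁ a₂ (step 0 a₁ g)) (- 1ℚ) (a₁ ℕ.∸ 1)
  completeSplitBasis {suc a₁} {suc (suc a₂)} g _ (s≤s (s≤s z≤n)) =
    MinusOneStep.eigenBasis loopless B₁ {{pos⇒nonZero (MinusOneStep.K {a = suc a₂} loopless B₁) {{K>0}}}} ,
    minusOneStep-nondegenerate {a = suc a₂} loopless B₁ _ _ K>0
    where
    loopless = step-loopless g
    B₁ = KernelStep.eigenBasis {a = a₁} (λ ()) (empty g)
    K>0 : Positive (MinusOneStep.K {a = suc a₂} loopless B₁)
    K>0 = nonNeg+pos⇒pos 0ℚ (fromℕ (suc a₂) * (0ℚ + 1ℚ)) {{pos*pos⇒pos (fromℕ (suc a₂)) {{fromℕ-pos a₂}} (0ℚ + 1ℚ)}}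

  completeBasis : ∀ n → NondegenerateBasis (step n 1 (λ _ _ → false)) (- 1ℚ) n
  completeBasis n = Complete.eigenBasis n , _ , _

open import Data.Nat using (ℕ; zero; suc; _+_; _*_; _∸_; _≤_; z≤n; s≤s)
open import Data.Nat.Properties
  using (≤-refl; ≤-trans; ≤-reflexive; n≤1+n; m≤n⇒m≤1+n; m≤m+n; m≤n+m; m∸n≤m; +-comm; +-assoc; +-suc;
         +-mono-≤; *-monoʳ-≤; *-suc; +-∸-comm; +-∸-assoc; ≤∧≢⇒<)
open import Data.Product using (_×_; _,_)
open import Data.Rational using (ℚ; 0ℚ; -_; 1ℚ)
open import Function using (_∘_)
open import Relation.Binary.PropositionalEquality using (_≡_; _≢_; refl; sym; trans; cong; subst; module ≡-Reasoning)
open Join using (Loopless; step-loopless)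
open EigenBases
  using (NondegenerateBasis; nondegenerate-multiplicity; kernelStep; minusOneStep; edgelessBasis; completeSplitBasis; completeBasis)

sumTo-≥ : ∀ {f} k → (∀ i → 1 ≤ i → i ≤ k → 1 ≤ f i) → k ≤ sumTo f k
sumTo-≥ zero _ = z≤n
sumTo-≥ {f} (suc k) pos = subst (_≤ sumTo f (suc k)) (+-comm k 1)
  (+-mono-≤ (sumTo-≥ k (λ i 1≤i i≤k → pos i 1≤i (m≤n⇒m≤1+n i≤k))) (pos (suc k) (s≤s z≤n) ≤-refl))

sumTo-∸1 : ∀ {f} k → (∀ i → 1 ≤ i → i ≤ k → 1 ≤ f i) → sumTo (λ i → f i ∸ 1) k ≡ sumTo f k ∸ k
sumTo-∸1 zero _ = refl
sumTo-∸1 {f} (suc k) pos = begin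
  sumTo (λ i → f i ∸ 1) k + (f (suc k) ∸ 1)
    ≡⟨ cong (_+ (f (suc k) ∸ 1)) (sumTo-∸1 k pos′) ⟩
  (sumTo f k ∸ k) + (f (suc k) ∸ 1)
    ≡⟨ shift (sumTo f k) (f (suc k)) (sumTo-≥ k pos′) (pos (suc k) (s≤s z≤n) ≤-refl) ⟩
  (sumTo f k + f (suc k)) ∸ suc k ∎
  where
  open ≡-Reasoning
  pos′ : ∀ i → 1 ≤ i → i ≤ k → 1 ≤ f i
  pos′ i 1≤i i≤k = pos i 1≤i (m≤n⇒m≤1+n i≤k)
  shift : ∀ X y → k ≤ X → 1 ≤ y → (X ∸ k) + (y ∸ 1) ≡ (X + y) ∸ suc k
  shift X (suc y) k≤X _ = trans (sym (+-∸-comm y k≤X)) (cong (_∸ suc k) (sym (+-suc X y)))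

adj-loopless : ∀ α i → Loopless (adj α i)
adj-loopless α zero = λ ()
adj-loopless α (suc zero) = λ _ → refl
adj-loopless α (suc (suc i)) = step-loopless (adj α (suc i))

PositiveUpTo : (ℕ → ℕ) → ℕ → Set
PositiveUpTo α L = ∀ i → 1 ≤ i → i ≤ L → 1 ≤ α i

module Chains (α : ℕ → ℕ) where

  BasisAt : ℚ → ℕ → ℕ → Set
  BasisAt μ i m = NondegenerateBasis (adj α i) μ m

  private
    next-levels : ∀ {j} → PositiveUpTo α (2 * suc j) →
                  1 ≤ α (suc (2 * j)) × 1 ≤ α (suc (suc (2 * j))) × PositiveUpTo α (2 * j)
    next-levels {j} pos =
      pos _ (s≤s z≤n) (≤-trans (n≤1+n _) top) , pos _ (s≤s z≤n) top ,
      λ i 1≤i i≤2j → pos i 1≤i (≤-trans i≤2j (*-monoʳ-≤ 2 (n≤1+n j)))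
      where
      top : suc (suc (2 * j)) ≤ 2 * suc j
      top = ≤-reflexive (sym (*-suc 2 j))

  kernelChain : ∀ j → PositiveUpTo α (2 * suc j) → BasisAt 0ℚ (2 * suc j) (sumTo (λ i → α (2 * i) ∸ 1) (suc j))
  kernelChain zero pos =
    kernelStep (pos 2 (s≤s z≤n) ≤-refl) (adj-loopless α 1) (edgelessBasis (adj α 0) (pos 1 (s≤s z≤n) (s≤s z≤n)))
  kernelChain (suc j) pos with next-levels {suc j} pos
  ... | α-odd≥1 , α-even≥1 , pos′ =
    subst (λ L → BasisAt 0ℚ L (sumTo (λ i → α (2 * i) ∸ 1) (suc j) + (α L ∸ 1))) (sym (*-suc 2 (suc j)))
      (kernelStep α-even≥1 (adj-loopless α _) (minusOneStep α-odd≥1 (adj-loopless α _) (kernelChain j pos′)))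

  minusOneChain : ∀ {e} → BasisAt (- 1ℚ) 2 (e + (α 1 ∸ 1)) → ∀ j → PositiveUpTo α (2 * suc j) →
                  BasisAt (- 1ℚ) (2 * suc j) (e + sumTo (λ i → α (2 * i ∸ 1) ∸ 1) (suc j))
  minusOneChain base zero pos = base
  minusOneChain {e} base (suc j) pos with next-levels {suc j} pos
  ... | α-odd≥1 , α-even≥1 , pos′ =
    subst (λ L → BasisAt (- 1ℚ) L (e + (sumTo (λ i → α (2 * i ∸ 1) ∸ 1) (suc j) + (α (L ∸ 1) ∸ 1))))
          (sym (*-suc 2 (suc j)))
      (subst (BasisAt (- 1ℚ) _) (+-assoc e _ _)
        (minusOneStep α-even≥1 (adj-loopless α _) (kernelStep α-odd≥1 (adj-loopless α _) (minusOneChain base j pos′))))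

  completeSplitBase : PositiveUpTo α 2 → α 2 ≢ 1 → BasisAt (- 1ℚ) 2 (0 + (α 1 ∸ 1))
  completeSplitBase pos α₂≢1 =
    completeSplitBasis (adj α 0) (pos 1 (s≤s z≤n) (s≤s z≤n)) (≤∧≢⇒< (pos 2 (s≤s z≤n) ≤-refl) (α₂≢1 ∘ sym))

  completeBase : PositiveUpTo α 2 → α 2 ≡ 1 → BasisAt (- 1ℚ) 2 (1 + (α 1 ∸ 1))
  completeBase pos α₂≡1 =
    subst (BasisAt (- 1ℚ) 2) (+-∸-assoc 1 (pos 1 (s≤s z≤n) (s≤s z≤n)))
      (subst (λ a → NondegenerateBasis (step (α 1) a (adj α 1)) (- 1ℚ) (α 1)) (sym α₂≡1) (completeBasis (α 1)))

mainTheorem8 : (k : ℕ) → 1 ≤ k → (α : ℕ → ℕ) →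
    (∀ i → 1 ≤ i → i ≤ 2 * k → 1 ≤ α i) →
    EigenMultiplicity (adjMat α (2 * k)) 0ℚ (sumTo (λ i → α (2 * i)) k ∸ k)
    × (α 2 ≢ 1 → EigenMultiplicity (adjMat α (2 * k)) (- 1ℚ) (sumTo (λ i → α (2 * i ∸ 1)) k ∸ k))
    × (α 2 ≡ 1 → EigenMultiplicity (adjMat α (2 * k)) (- 1ℚ) (sumTo (λ i → α (2 * i ∸ 1)) k ∸ k + 1))
mainTheorem8 (suc j) _ α pos =
  subst (EigenMultiplicity (adjMat α (2 * suc j)) 0ℚ) (sumTo-∸1 (suc j) evens)
        (nondegenerate-multiplicity (kernelChain j pos)) ,
  (λ α₂≢1 → subst (EigenMultiplicity (adjMat α (2 * suc j)) (- 1ℚ)) (sumTo-∸1 (suc j) odds)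
                  (nondegenerate-multiplicity (minusOneChain (completeSplitBase pos₂ α₂≢1) j pos))) ,
  (λ α₂≡1 → subst (EigenMultiplicity (adjMat α (2 * suc j)) (- 1ℚ))
                  (trans (+-comm 1 _) (cong (_+ 1) (sumTo-∸1 (suc j) odds)))
                  (nondegenerate-multiplicity (minusOneChain (completeBase pos₂ α₂≡1) j pos)))
  where
  open Chains α
  pos₂ : PositiveUpTo α 2
  pos₂ i 1≤i i≤2 = pos i 1≤i (≤-trans i≤2 (*-monoʳ-≤ 2 (s≤s z≤n)))
  evens : ∀ i → 1 ≤ i → i ≤ suc j → 1 ≤ α (2 * i)
  evens i 1≤i i≤k = pos (2 * i) (≤-trans 1≤i (m≤m+n i (i + 0))) (*-monoʳ-≤ 2 i≤k)
  odds : ∀ i → 1 ≤ i → i ≤ suc j → 1 ≤ α (2 * i ∸ 1)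
  odds (suc i) _ i≤k =
    pos (2 * suc i ∸ 1) (≤-trans (s≤s z≤n) (m≤n+m (suc i + 0) i)) (≤-trans (m∸n≤m (2 * suc i) 1) (*-monoʳ-≤ 2 i≤k))
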